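{- Let $n$ be a composite almost-prime number. Then every prime divisor of $n$ is smaller than $d(n)$.
   Context: For a positive integer $n$ with positive divisors $1=d_1<d_2<\dots<d_k=n$, define the polynomial $T_n(x)=x^{d_1}+x^{d_2}+\dots+x^{d_k}-kx$. A positive integer $n$ is called weakly almost-prime if $n\mid T_n(x)$ for all integers $x$; it is called almost-prime if it is weakly almost-prime and square-free. $d(n)$ denotes the number of positive divisors of $n$. -}

module Defs where

open import Data.Nat using (ℕ; suc; _<_; _*_)
open import Data.Nat.Divisibility using (_∣_; _∣?_)
open import Data.Nat.Primality using (Prime)
open import Data.List using (List; filter; upTo; length; map; sum; foldr)
open import Data.Empty using (⊥)
open import Data.Product using (_×_)
open import Data.Integer as ℤ using (ℤ; +_)
import Data.Integer.Divisibility as ℤD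

-- The positive divisors of n, in increasing order: d ∈ {1,…,n} with d ∣ n.
-- (For n = 0 this list is empty; the statement only concerns composite n.)
divisors : ℕ → List ℕ
divisors n = filter (_∣? n) (map suc (upTo n))

numDivisors : ℕ → ℕ
numDivisors n = length (divisors n)

T : ℕ → ℤ → ℤ
T n x = foldr (λ d acc → (x ℤ.^ d) ℤ.+ acc) (+ 0) (divisors n)
        ℤ.- ((+ numDivisors n) ℤ.* x)

WeaklyAlmostPrime : ℕ → Set
WeaklyAlmostPrime n = ∀ (x : ℤ) → (+ n) ℤD.∣ T n x

SquareFree : ℕ → Set
SquareFree n = ∀ (p : ℕ) → Prime p → (p * p) ∣ n → ⊥

AlmostPrime : ℕ → Set
AlmostPrime n = WeaklyAlmostPrime n × SquareFree n

-- Let r be a prime divisor of a weakly almost-prime n with d(n) ≤ r. Modulo r, Fermat's little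
-- theorem lets every exponent d of T_n be replaced by 0 (if d = 0) or 1 + (d - 1) mod (r - 1),
-- turning T_n into a polynomial of degree < r that vanishes at all r residues, so r divides all
-- of its coefficients. For j ≠ 1 the coefficient of x^j counts the divisors with reduced exponent
-- j; the divisor 1 is not among them, so the count is below d(n) ≤ r and must be 0. Hence every
-- divisor of n is ≡ 1 mod (r - 1), and in particular r ≤ q for every prime divisor q of n.
-- A composite square-free n has two distinct prime divisors p and q; if d(n) ≤ p this gives
-- p ≤ q, hence d(n) ≤ q and q ≤ p, which is absurd.
module Submission where

open import Defs
open import Data.Nat using (ℕ; _<_)
open import Data.Nat.Divisibility using (_∣_)
open import Data.Nat.Primality using (Prime; Composite)

open import Data.Fin.Base using (zero; suc; toℕ; inject₁; fromℕ)
open import Data.Fin.Properties using (toℕ<n; toℕ-inject₁; toℕ-fromℕ)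
open import Data.Integer as ℤ using (ℤ; +_; _+_; _-_; -_; _*_; _^_)
import Data.Integer.Properties as ℤ
open import Data.Integer.Divisibility.Signed as ℤ
  using (∣ᵤ⇒∣; ∣⇒∣ᵤ; ∣m∣n⇒∣m+n; ∣m∣n⇒∣m-n; ∣m+n∣n⇒∣m; ∣m⇒∣m*n; ∣n⇒∣m*n; ∣m⇒∣-m)
open import Data.Integer.Tactic.RingSolver using (solve-∀)
open import Data.List using (List; []; _∷_; length; applyUpTo; filter; foldr; map)
open import Data.List.Membership.Propositional using (_∈_)
open import Data.List.Membership.Propositional.Properties
  using (∈-applyUpTo⁺; ∈-filter⁺; ∈-map⁺; ∈-upTo⁺)
open import Data.List.Properties
  using (filter-accept; filter-reject; filter-notAll; filter-some; length-applyUpTo; length-map)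
open import Data.List.Relation.Unary.All as All using (All; []; _∷_)
open import Data.List.Relation.Unary.All.Properties as All using ()
import Data.List.Relation.Unary.Any as Any
open import Data.Nat as ℕ using (zero; suc; s≤s; z≤n; _≤_; _!; NonZero; 2+; _≟_)
open import Data.Nat.Combinatorics using (_C_; k![n∸k]!∣n!; nCn≡1)
open import Data.Nat.Combinatorics.Specification using (nCk≡n!/k![n-k]!)
open import Data.Nat.Divisibility
  using (divides; _∣?_; 1∣_; ∣-trans; m∣m*n; *-monoˡ-∣; ∣⇒≤; 0∣⇒≡0; ∣1⇒≡1; m%n≡0⇒n∣m)
open import Data.Nat.DivMod using (_/_; _%_; m/n*n≡m; m≡m%n+[m/n]*n; m%n<n)
open import Data.Nat.ListAction using (product)
open import Data.Nat.Primality
  using (euclidsLemma; prime⇒nonTrivial; composite⇒nonZero; composite⇒¬prime)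
open import Data.Nat.Primality.Factorisation using (factorise)
import Data.Nat.Properties as ℕ
open import Data.Product using (∃-syntax; _×_; _,_)
open import Data.Sum using (_⊎_; inj₁; inj₂)
open import Data.Vec.Functional using (Vector; tail; init; last)
open import Function.Base using (_∘_)
open import Relation.Binary.Bundles using (Setoid)
open import Relation.Binary.Definitions using (Reflexive; Symmetric; Transitive)
open import Relation.Binary.PropositionalEquality
import Relation.Binary.Reasoning.Setoid as ≈-Reasoning
open import Relation.Binary.Structures using (IsEquivalence)
open import Relation.Nullary using (¬_; contradiction; yes; no)

open import Algebra.Definitions.RawMonoid ℤ.+-0-rawMonoid using (sum) renaming (_×_ to _×ₛ_)
open import Algebra.Properties.CommutativeSemiring.Binomial ℤ.+-*-commutativeSemiring
  using (binomialTerm) renaming (theorem to binomial-theorem)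
open import Algebra.Properties.Monoid.Sum ℤ.+-0-monoid using (sum-init-last)
open import Algebra.Properties.Semiring.Exp ℤ.+-*-semiring using () renaming (_^_ to _^ₛ_)

infix 4 _≡_mod_

record _≡_mod_ (x y : ℤ) (m : ℕ) : Set where
  constructor ≡mod
  field
    m∣x-y : + m ℤ.∣ x - y

module _ {m : ℕ} where

  ≡mod-refl : Reflexive (_≡_mod m)
  ≡mod-refl {x} = ≡mod (ℤ.divides (+ 0) (ℤ.+-inverseʳ x))

  ≡mod-sym : Symmetric (_≡_mod m)
  ≡mod-sym {x} {y} (≡mod m∣x-y) = ≡mod (subst (+ m ℤ.∣_) (negate x y) (∣m⇒∣-m m∣x-y))
    where
    negate : ∀ x y → - (x - y) ≡ y - x
    negate = solve-∀

  ≡mod-trans : Transitive (_≡_mod m)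
  ≡mod-trans {x} {y} {z} (≡mod m∣x-y) (≡mod m∣y-z) =
    ≡mod (subst (+ m ℤ.∣_) (telescope x y z) (∣m∣n⇒∣m+n m∣x-y m∣y-z))
    where
    telescope : ∀ x y z → (x - y) + (y - z) ≡ x - z
    telescope = solve-∀

  ≡mod-isEquivalence : IsEquivalence (_≡_mod m)
  ≡mod-isEquivalence = record { refl = ≡mod-refl ; sym = ≡mod-sym ; trans = ≡mod-trans }

  ≡mod-+ : ∀ {x y u v} → x ≡ y mod m → u ≡ v mod m → x + u ≡ y + v mod m
  ≡mod-+ {x} {y} {u} {v} (≡mod m∣x-y) (≡mod m∣u-v) =
    ≡mod (subst (+ m ℤ.∣_) (regroup x y u v) (∣m∣n⇒∣m+n m∣x-y m∣u-v))
    where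
    regroup : ∀ x y u v → (x - y) + (u - v) ≡ (x + u) - (y + v)
    regroup = solve-∀

  ≡mod-*ʳ : ∀ {x y} z → x ≡ y mod m → x * z ≡ y * z mod m
  ≡mod-*ʳ {x} {y} z (≡mod m∣x-y) = ≡mod (subst (+ m ℤ.∣_) (distrib z x y) (∣m⇒∣m*n z m∣x-y))
    where
    distrib : ∀ z x y → (x - y) * z ≡ x * z - y * z
    distrib = solve-∀

  ∣-resp-≡mod : ∀ {x y} → x ≡ y mod m → + m ℤ.∣ x → + m ℤ.∣ y
  ∣-resp-≡mod {x} {y} (≡mod m∣x-y) m∣x = subst (+ m ℤ.∣_) (cancel x y) (∣m∣n⇒∣m-n m∣x m∣x-y)
    where
    cancel : ∀ x y → x - (x - y) ≡ y
    cancel = solve-∀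

≡mod-setoid : ℕ → Setoid _ _
≡mod-setoid m = record { isEquivalence = ≡mod-isEquivalence {m} }

-- Fermat's little theorem

m<p⇒p∤m! : ∀ {p m} → Prime p → m < p → ¬ p ∣ m !
m<p⇒p∤m! {m = zero}  p-prime _   p∣1  = ℕ.nonTrivial⇒≢1 {{prime⇒nonTrivial p-prime}} (∣1⇒≡1 p∣1)
m<p⇒p∤m! {m = suc m} p-prime m<p p∣m! with euclidsLemma (suc m) (m !) p-prime p∣m!
... | inj₁ p∣1+m = ℕ.<⇒≱ m<p (∣⇒≤ p∣1+m)
... | inj₂ p∣m!  = m<p⇒p∤m! p-prime (ℕ.<-trans (ℕ.n<1+n m) m<p) p∣m!

nCk*k![n∸k]!≡n! : ∀ {n k} → k ≤ n → (n C k) ℕ.* (k ! ℕ.* (n ℕ.∸ k) !) ≡ n !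
nCk*k![n∸k]!≡n! {n} {k} k≤n = begin
  (n C k) ℕ.* D          ≡⟨ cong (ℕ._* D) (nCk≡n!/k![n-k]! k≤n) ⟩
  (n ! / D) ℕ.* D        ≡⟨ m/n*n≡m (k![n∸k]!∣n! k≤n) ⟩
  n !                    ∎
  where
  open ≡-Reasoning
  D = k ! ℕ.* (n ℕ.∸ k) !
  instance _ = ℕ._!*_!≢0 k (n ℕ.∸ k)

p∣pCk : ∀ {p k} → Prime p → 0 < k → k < p → p ∣ p C k
p∣pCk {suc q} {k} p-prime 0<k k<p
  with euclidsLemma (suc q C k) (k ! ℕ.* (suc q ℕ.∸ k) !) p-prime
         (subst (suc q ∣_) (sym (nCk*k![n∸k]!≡n! (ℕ.<⇒≤ k<p))) (m∣m*n (q !)))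
... | inj₁ p∣pCk = p∣pCk
... | inj₂ p∣k![p∸k]! with euclidsLemma (k !) ((suc q ℕ.∸ k) !) p-prime p∣k![p∸k]!
...   | inj₁ p∣k!     = contradiction p∣k! (m<p⇒p∤m! p-prime k<p)
...   | inj₂ p∣[p∸k]! = contradiction p∣[p∸k]! (m<p⇒p∤m! p-prime (ℕ.∸-monoʳ-< 0<k (ℕ.<⇒≤ k<p)))

^ₛ≡^ : ∀ x n → x ^ₛ n ≡ x ^ n
^ₛ≡^ x zero    = refl
^ₛ≡^ x (suc n) = cong (x *_) (^ₛ≡^ x n)

×ₛ≡* : ∀ n x → n ×ₛ x ≡ + n * x
×ₛ≡* zero    x = sym (ℤ.*-zeroˡ x)
×ₛ≡* (suc n) x = trans (cong (λ y → x + y) (×ₛ≡* n x)) (sym (ℤ.suc-* (+ n) x))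

∣-sum : ∀ {d n} (t : Vector ℤ n) → (∀ i → d ℤ.∣ t i) → d ℤ.∣ sum t
∣-sum {n = zero}  t d∣t = ℤ.divides (+ 0) refl
∣-sum {n = suc n} t d∣t = ∣m∣n⇒∣m+n (d∣t zero) (∣-sum (tail t) (d∣t ∘ suc))

freshman-dream : ∀ {p} → Prime p → ∀ x y → (x + y) ^ p ≡ x ^ p + y ^ p mod p
freshman-dream {suc q} p-prime x y =
  ≡mod (subst (+ p ℤ.∣_) expansion (∣-sum (init (tail t)) p∣middle-term))
  where
  p = suc q
  t = binomialTerm x y p
  term : ∀ k → t k ≡ + (p C toℕ k) * (x ^ toℕ k * y ^ (p ℕ.∸ toℕ k))
  term k = trans (×ₛ≡* (p C toℕ k) _)
    (cong (+ (p C toℕ k) *_) (cong₂ _*_ (^ₛ≡^ x (toℕ k)) (^ₛ≡^ y (p ℕ.∸ toℕ k))))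
  first-term : t zero ≡ y ^ p
  first-term = trans (term zero) (trans (ℤ.*-identityˡ _) (ℤ.*-identityˡ (y ^ p)))
  last-term : last (tail t) ≡ x ^ p
  last-term = begin
    last (tail t)
      ≡⟨ term (suc (fromℕ q)) ⟩
    + (p C suc (toℕ (fromℕ q))) * (x ^ suc (toℕ (fromℕ q)) * y ^ (q ℕ.∸ toℕ (fromℕ q)))
      ≡⟨ cong (λ k → + (p C suc k) * (x ^ suc k * y ^ (q ℕ.∸ k))) (toℕ-fromℕ q) ⟩
    + (p C p) * (x ^ p * y ^ (q ℕ.∸ q))
      ≡⟨ cong₂ (λ c e → + c * (x ^ p * y ^ e)) (nCn≡1 p) (ℕ.n∸n≡0 q) ⟩
    + 1 * (x ^ p * + 1)
      ≡⟨ trans (ℤ.*-identityˡ _) (ℤ.*-identityʳ (x ^ p)) ⟩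
    x ^ p ∎
    where open ≡-Reasoning
  p∣middle-term : ∀ i → + p ℤ.∣ init (tail t) i
  p∣middle-term i = subst (+ p ℤ.∣_) (sym (term k)) (∣m⇒∣m*n (x ^ toℕ k * y ^ (p ℕ.∸ toℕ k)) p∣pCk′)
    where
    k = suc (inject₁ i)
    p∣pCk′ : + p ℤ.∣ + (p C toℕ k)
    p∣pCk′ = ∣ᵤ⇒∣ (p∣pCk p-prime (s≤s z≤n) (s≤s (subst (_< q) (sym (toℕ-inject₁ i)) (toℕ<n i))))
  expansion : sum (init (tail t)) ≡ (x + y) ^ p - (x ^ p + y ^ p)
  expansion = begin
    M                                        ≡⟨ cancel M (x ^ p) (y ^ p) ⟩
    (y ^ p + (M + x ^ p)) - S                ≡⟨ cong₂ (λ a b → (a + (M + b)) - S) (sym first-term) (sym last-term) ⟩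
    (t zero + (M + last (tail t))) - S       ≡⟨ cong (λ s → (t zero + s) - S) (sym (sum-init-last (tail t))) ⟩
    sum t - S                                ≡⟨ cong (_- S) (sym (binomial-theorem p x y)) ⟩
    (x + y) ^ₛ p - S                         ≡⟨ cong (_- S) (^ₛ≡^ (x + y) p) ⟩
    (x + y) ^ p - S                          ∎
    where
    open ≡-Reasoning
    M = sum (init (tail t))
    S = x ^ p + y ^ p
    cancel : ∀ m a b → m ≡ (b + (m + a)) - (a + b)
    cancel = solve-∀

fermat : ∀ {p} → Prime p → ∀ a → (+ a) ^ p ≡ + a mod p
fermat {suc q} p-prime zero    = ≡mod-refl
fermat {p}     p-prime (suc a) = begin
  (+ 1 + + a) ^ p        ≈⟨ freshman-dream p-prime (+ 1) (+ a) ⟩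
  (+ 1) ^ p + (+ a) ^ p  ≡⟨ cong (_+ (+ a) ^ p) (ℤ.^-zeroˡ p) ⟩
  + 1 + (+ a) ^ p        ≈⟨ ≡mod-+ (≡mod-refl {x = + 1}) (fermat p-prime a) ⟩
  + 1 + + a              ∎
  where open ≈-Reasoning (≡mod-setoid p)

-- Reducing exponents modulo a period

reduce : (P : ℕ) .{{_ : NonZero P}} → ℕ → ℕ
reduce P zero    = 0
reduce P (suc d) = suc (d % P)

reduce≤ : ∀ P .{{_ : NonZero P}} d → reduce P d ≤ P
reduce≤ P zero    = z≤n
reduce≤ P (suc d) = m%n<n d P

reduce≡1⇒∣pred : ∀ P .{{_ : NonZero P}} d → reduce P d ≡ 1 → P ∣ ℕ.pred d
reduce≡1⇒∣pred P (suc d) eq = m%n≡0⇒n∣m d P (ℕ.suc-injective eq)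

module _ {m P : ℕ} .{{_ : NonZero P}} {x : ℤ} (period : x ^ suc P ≡ x mod m) where
  open ≈-Reasoning (≡mod-setoid m)

  ^-periodic : ∀ e → x ^ suc (P ℕ.+ e) ≡ x ^ suc e mod m
  ^-periodic e = begin
    x ^ (suc P ℕ.+ e)  ≡⟨ ℤ.^-distribˡ-+-* x (suc P) e ⟩
    x ^ suc P * x ^ e  ≈⟨ ≡mod-*ʳ (x ^ e) period ⟩
    x * x ^ e          ∎

  ^-periodic* : ∀ q e → x ^ suc (q ℕ.* P ℕ.+ e) ≡ x ^ suc e mod m
  ^-periodic* zero    e = ≡mod-refl
  ^-periodic* (suc q) e = begin
    x ^ suc (P ℕ.+ q ℕ.* P ℕ.+ e)    ≡⟨ cong (λ k → x ^ suc k) (ℕ.+-assoc P (q ℕ.* P) e) ⟩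
    x ^ suc (P ℕ.+ (q ℕ.* P ℕ.+ e))  ≈⟨ ^-periodic (q ℕ.* P ℕ.+ e) ⟩
    x ^ suc (q ℕ.* P ℕ.+ e)          ≈⟨ ^-periodic* q e ⟩
    x ^ suc e                        ∎

  ^-reduce : ∀ d → x ^ d ≡ x ^ reduce P d mod m
  ^-reduce zero    = ≡mod-refl
  ^-reduce (suc d) = begin
    x ^ suc d                          ≡⟨ cong (λ k → x ^ suc k) division ⟩
    x ^ suc ((d / P) ℕ.* P ℕ.+ d % P)  ≈⟨ ^-periodic* (d / P) (d % P) ⟩
    x ^ suc (d % P)                    ∎
    where
    division : d ≡ (d / P) ℕ.* P ℕ.+ d % P
    division = trans (m≡m%n+[m/n]*n d P) (ℕ.+-comm (d % P) ((d / P) ℕ.* P))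

-- Polynomials over ℤ modulo a prime

eval : List ℤ → ℤ → ℤ
eval []       x = + 0
eval (c ∷ cs) x = c + x * eval cs x

quotient : ℤ → List ℤ → List ℤ
quotient a []           = []
quotient a (c ∷ [])     = []
quotient a (c ∷ c′ ∷ f) = eval (c′ ∷ f) a ∷ quotient a (c′ ∷ f)

length-quotient : ∀ a f → length (quotient a f) ≡ ℕ.pred (length f)
length-quotient a []           = refl
length-quotient a (c ∷ [])     = refl
length-quotient a (c ∷ c′ ∷ f) = cong suc (length-quotient a (c′ ∷ f))

eval-quotient : ∀ a f x → eval f x ≡ (x - a) * eval (quotient a f) x + eval f a
eval-quotient a []           x = lemma a x
  where
  lemma : ∀ a x → + 0 ≡ (x - a) * + 0 + + 0
  lemma = solve-∀
eval-quotient a (c ∷ [])     x = lemma a c x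
  where
  lemma : ∀ a c x → c + x * + 0 ≡ (x - a) * + 0 + (c + a * + 0)
  lemma = solve-∀
eval-quotient a (c ∷ c′ ∷ f) x = begin
  c + x * g x                                    ≡⟨ cong (λ v → c + x * v) (eval-quotient a (c′ ∷ f) x) ⟩
  c + x * ((x - a) * q x + g a)                  ≡⟨ lemma a c x (q x) (g a) ⟩
  (x - a) * (g a + x * q x) + (c + a * g a)      ∎
  where
  open ≡-Reasoning
  g = eval (c′ ∷ f)
  q = eval (quotient a (c′ ∷ f))
  lemma : ∀ a c x q g → c + x * ((x - a) * q + g) ≡ (x - a) * (g + x * q) + (c + a * g)
  lemma = solve-∀

∣-quotient⇒∣-coefficients : ∀ {d} a f → d ℤ.∣ eval f a → All (d ℤ.∣_) (quotient a f) →
  All (d ℤ.∣_) f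
∣-quotient⇒∣-coefficients     a []           _    _ = []
∣-quotient⇒∣-coefficients {d} a (c ∷ [])     d∣fa _ =
  subst (d ℤ.∣_) (trans (cong (λ v → c + v) (ℤ.*-zeroʳ a)) (ℤ.+-identityʳ c)) d∣fa ∷ []
∣-quotient⇒∣-coefficients {d} a (c ∷ c′ ∷ f) d∣fa (d∣ga ∷ d∣q) =
  subst (d ℤ.∣_) (cancel c a (eval (c′ ∷ f) a)) (∣m∣n⇒∣m-n d∣fa (∣n⇒∣m*n a d∣ga))
    ∷ ∣-quotient⇒∣-coefficients a (c′ ∷ f) d∣ga d∣q
  where
  cancel : ∀ c a g → (c + a * g) - a * g ≡ c
  cancel = solve-∀

euclidsLemmaℤ : ∀ {p} x y → Prime p → + p ℤ.∣ x * y → + p ℤ.∣ x ⊎ + p ℤ.∣ y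
euclidsLemmaℤ {p} x y p-prime p∣xy
  with euclidsLemma ℤ.∣ x ∣ ℤ.∣ y ∣ p-prime (subst (p ∣_) (ℤ.abs-* x y) (∣⇒∣ᵤ p∣xy))
... | inj₁ p∣x = inj₁ (∣ᵤ⇒∣ p∣x)
... | inj₂ p∣y = inj₂ (∣ᵤ⇒∣ p∣y)

m<n<r⇒r∤m-n : ∀ {m n r} → m < n → n < r → ¬ (+ r ℤ.∣ + m - + n)
m<n<r⇒r∤m-n {m} {n} {r} m<n n<r r∣m-n =
  ℕ.<⇒≱ (ℕ.≤-<-trans (ℕ.m∸n≤m n m) n<r) (∣⇒≤ {{ℕ.>-nonZero (ℕ.m<n⇒0<n∸m m<n)}} r∣n∸m)
  where
  r∣n∸m : r ∣ n ℕ.∸ m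
  r∣n∸m = subst (r ∣_) (trans (cong ℤ.∣_∣ (ℤ.[+m]-[+n]≡m⊖n m n)) (ℤ.∣⊖∣-< m<n)) (∣⇒∣ᵤ r∣m-n)

vanishing⇒∣-coefficients : ∀ {r} → Prime r → ∀ L f → length f ≤ L → L ≤ r →
  (∀ b → b < L → + r ℤ.∣ eval f (+ b)) → All (+ r ℤ.∣_) f
vanishing⇒∣-coefficients r-prime zero    []  _       _     _        = []
-- Divide out the root L: the quotient still vanishes at every b < L because r ∤ b - L.
vanishing⇒∣-coefficients {r} r-prime (suc L) f |f|≤1+L 1+L≤r vanishes =
  ∣-quotient⇒∣-coefficients (+ L) f (vanishes L ℕ.≤-refl)
    (vanishing⇒∣-coefficients r-prime L (quotient (+ L) f) |q|≤L (ℕ.<⇒≤ 1+L≤r) q-vanishes)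
  where
  |q|≤L : length (quotient (+ L) f) ≤ L
  |q|≤L = subst (_≤ L) (sym (length-quotient (+ L) f)) (ℕ.pred-mono-≤ |f|≤1+L)
  q-vanishes : ∀ b → b < L → + r ℤ.∣ eval (quotient (+ L) f) (+ b)
  q-vanishes b b<L with euclidsLemmaℤ (+ b - + L) _ r-prime
    (∣m+n∣n⇒∣m (subst (+ r ℤ.∣_) (eval-quotient (+ L) f (+ b)) (vanishes b (ℕ.m<n⇒m<1+n b<L)))
               (vanishes L ℕ.≤-refl))
  ... | inj₁ r∣b-L = contradiction r∣b-L (m<n<r⇒r∤m-n b<L 1+L≤r)
  ... | inj₂ r∣q   = r∣q

-- Power sums as polynomials

δ : ℕ → ℕ → ℕ
δ zero    zero    = 1
δ zero    (suc j) = 0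
δ (suc i) zero    = 0
δ (suc i) (suc j) = δ i j

δ-refl : ∀ i → δ i i ≡ 1
δ-refl zero    = refl
δ-refl (suc i) = δ-refl i

δ-≢ : ∀ {i j} → i ≢ j → δ i j ≡ 0
δ-≢ {zero}  {zero}  i≢j = contradiction refl i≢j
δ-≢ {zero}  {suc j} _   = refl
δ-≢ {suc i} {zero}  _   = refl
δ-≢ {suc i} {suc j} i≢j = δ-≢ (i≢j ∘ cong suc)

module _ (x : ℤ) where

  evalUpTo : (ℕ → ℤ) → ℕ → ℤ
  evalUpTo c L = eval (applyUpTo c L) x

  evalUpTo-cong : ∀ {c c′} L → (∀ j → c j ≡ c′ j) → evalUpTo c L ≡ evalUpTo c′ L
  evalUpTo-cong zero    c≗c′ = refl
  evalUpTo-cong (suc L) c≗c′ = cong₂ (λ a v → a + x * v) (c≗c′ 0) (evalUpTo-cong L (c≗c′ ∘ suc))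

  evalUpTo-0 : ∀ L → evalUpTo (λ _ → + 0) L ≡ + 0
  evalUpTo-0 zero    = refl
  evalUpTo-0 (suc L) = trans (cong (λ v → + 0 + x * v) (evalUpTo-0 L))
                             (trans (ℤ.+-identityˡ (x * + 0)) (ℤ.*-zeroʳ x))

  evalUpTo-+ : ∀ c c′ L → evalUpTo (λ j → c j + c′ j) L ≡ evalUpTo c L + evalUpTo c′ L
  evalUpTo-+ c c′ zero    = refl
  evalUpTo-+ c c′ (suc L) =
    trans (cong (λ v → c 0 + c′ 0 + x * v) (evalUpTo-+ (c ∘ suc) (c′ ∘ suc) L))
    (lemma (c 0) (c′ 0) x (evalUpTo (c ∘ suc) L) (evalUpTo (c′ ∘ suc) L))
    where
    lemma : ∀ a b x u v → a + b + x * (u + v) ≡ a + x * u + (b + x * v)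
    lemma = solve-∀

  evalUpTo-* : ∀ s c L → evalUpTo (λ j → s * c j) L ≡ s * evalUpTo c L
  evalUpTo-* s c zero    = sym (ℤ.*-zeroʳ s)
  evalUpTo-* s c (suc L) = trans (cong (λ v → s * c 0 + x * v) (evalUpTo-* s (c ∘ suc) L))
    (lemma s (c 0) x (evalUpTo (c ∘ suc) L))
    where
    lemma : ∀ s a x u → s * a + x * (s * u) ≡ s * (a + x * u)
    lemma = solve-∀

  evalUpTo-δ : ∀ {i L} → i < L → evalUpTo (λ j → + δ i j) L ≡ x ^ i
  evalUpTo-δ {zero}  {suc L} _         = trans (cong (λ v → + 1 + x * v) (evalUpTo-0 L)) (lemma x)
    where
    lemma : ∀ x → + 1 + x * + 0 ≡ + 1
    lemma = solve-∀
  evalUpTo-δ {suc i} {suc L} (s≤s i<L) =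
    trans (cong (λ v → + 0 + x * v) (evalUpTo-δ i<L)) (ℤ.+-identityˡ (x * x ^ i))

multiplicity : ℕ → List ℕ → ℕ
multiplicity j es = length (filter (_≟ j) es)

multiplicity-∷ : ∀ e es j → multiplicity j (e ∷ es) ≡ δ e j ℕ.+ multiplicity j es
multiplicity-∷ e es j with e ≟ j
... | yes refl = trans (cong length (filter-accept (_≟ j) refl))
                       (cong (ℕ._+ multiplicity j es) (sym (δ-refl e)))
... | no  e≢j  = trans (cong length (filter-reject (_≟ j) e≢j))
                       (cong (ℕ._+ multiplicity j es) (sym (δ-≢ e≢j)))

-- The same fold as in T, so that T n x unfolds to powerSum (divisors n) x - + numDivisors n * x.
powerSum : List ℕ → ℤ → ℤ
powerSum es x = foldr (λ e acc → x ^ e + acc) (+ 0) es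

powerSum≡evalUpTo : ∀ {L} x es → All (_< L) es →
  powerSum es x ≡ evalUpTo x (λ j → + multiplicity j es) L
powerSum≡evalUpTo {L} x []       []           = sym (evalUpTo-0 x L)
powerSum≡evalUpTo {L} x (e ∷ es) (e<L ∷ es<L) = begin
  x ^ e + powerSum es x
    ≡⟨ cong₂ _+_ (sym (evalUpTo-δ x e<L)) (powerSum≡evalUpTo x es es<L) ⟩
  evalUpTo x (λ j → + δ e j) L + evalUpTo x (λ j → + multiplicity j es) L
    ≡⟨ sym (evalUpTo-+ x (λ j → + δ e j) (λ j → + multiplicity j es) L) ⟩
  evalUpTo x (λ j → + (δ e j ℕ.+ multiplicity j es)) L
    ≡⟨ evalUpTo-cong x L (λ j → cong +_ (sym (multiplicity-∷ e es j))) ⟩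
  evalUpTo x (λ j → + multiplicity j (e ∷ es)) L ∎
  where open ≡-Reasoning

powerSum-reduce : ∀ {m P} .{{_ : NonZero P}} {x} → x ^ suc P ≡ x mod m →
  ∀ ds → powerSum ds x ≡ powerSum (map (reduce P) ds) x mod m
powerSum-reduce period []       = ≡mod-refl
powerSum-reduce period (d ∷ ds) = ≡mod-+ (^-reduce period d) (powerSum-reduce period ds)

∣⇒∈divisors : ∀ {n d} .{{_ : NonZero n}} → d ∣ n → d ∈ divisors n
∣⇒∈divisors {n} {zero}  0∣n = contradiction (0∣⇒≡0 0∣n) (ℕ.≢-nonZero⁻¹ n)
∣⇒∈divisors {n} {suc d} d∣n = ∈-filter⁺ (_∣? n) (∈-map⁺ suc (∈-upTo⁺ (∣⇒≤ d∣n))) d∣n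

module _ {t n : ℕ} .{{_ : NonZero n}} (r-prime : Prime (2+ t)) (r∣T : ∀ x → + 2+ t ℤ.∣ T n x)
         (k≤r : numDivisors n ≤ 2+ t) where

  private
    r = 2+ t
    P = suc t
    k = numDivisors n
    es = map (reduce P) (divisors n)

  coefficient : ℕ → ℤ
  coefficient j = + multiplicity j es + (- + k) * + δ 1 j

  T≡evalUpTo-coefficient : ∀ b → T n (+ b) ≡ evalUpTo (+ b) coefficient r mod r
  T≡evalUpTo-coefficient b = begin
    powerSum (divisors n) x - + k * x        ≈⟨ ≡mod-+ (powerSum-reduce (fermat r-prime b) (divisors n)) ≡mod-refl ⟩
    powerSum es x - + k * x                  ≡⟨ cong₂ _+_ (powerSum≡evalUpTo x es es<r) (neg-* (+ k) x) ⟩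
    evalUpTo x μ r + (- + k) * x             ≡⟨ cong (λ v → evalUpTo x μ r + (- + k) * v) x≡evalUpTo-δ₁ ⟩
    evalUpTo x μ r + (- + k) * evalUpTo x δ₁ r
                                             ≡⟨ cong (λ v → evalUpTo x μ r + v) (sym (evalUpTo-* x (- + k) δ₁ r)) ⟩
    evalUpTo x μ r + evalUpTo x (λ j → (- + k) * δ₁ j) r
                                             ≡⟨ sym (evalUpTo-+ x μ (λ j → (- + k) * δ₁ j) r) ⟩
    evalUpTo x coefficient r                 ∎
    where
    open ≈-Reasoning (≡mod-setoid r)
    x = + b
    δ₁ : ℕ → ℤ
    δ₁ j = + δ 1 j
    μ : ℕ → ℤ
    μ j = + multiplicity j es
    x≡evalUpTo-δ₁ : x ≡ evalUpTo x δ₁ r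
    x≡evalUpTo-δ₁ = sym (trans (evalUpTo-δ x {1} {r} (s≤s (s≤s z≤n))) (ℤ.^-identityʳ x))
    neg-* : ∀ k x → - (k * x) ≡ (- k) * x
    neg-* = solve-∀
    es<r : All (_< r) es
    es<r = All.map⁺ (All.universal (λ d → s≤s (reduce≤ P d)) (divisors n))

  r∣coefficient : ∀ j → j < r → + r ℤ.∣ coefficient j
  r∣coefficient j j<r = All.lookup r∣coefficients (∈-applyUpTo⁺ coefficient j<r)
    where
    r∣coefficients : All (+ r ℤ.∣_) (applyUpTo coefficient r)
    r∣coefficients = vanishing⇒∣-coefficients r-prime r (applyUpTo coefficient r)
      (ℕ.≤-reflexive (length-applyUpTo coefficient r)) ℕ.≤-refl
      (λ b _ → ∣-resp-≡mod (T≡evalUpTo-coefficient b) (r∣T (+ b)))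

  reduce-divisor≡1 : ∀ {d} → d ∈ divisors n → reduce P d ≡ 1
  reduce-divisor≡1 {d} d∈ds with reduce P d ≟ 1
  ... | yes j≡1 = j≡1
  -- r divides m, yet 0 < m < d(n) ≤ r: d is counted in m and the divisor 1 is not.
  ... | no  j≢1 = contradiction (∣⇒≤ {{ℕ.>-nonZero 0<m}} r∣m) (ℕ.<⇒≱ (ℕ.<-≤-trans m<k k≤r))
    where
    j = reduce P d
    m = multiplicity j es
    coefficient≡m : coefficient j ≡ + m
    coefficient≡m = begin
      + m + (- + k) * + δ 1 j  ≡⟨ cong (λ v → + m + (- + k) * + v) (δ-≢ (j≢1 ∘ sym)) ⟩
      + m + (- + k) * + 0      ≡⟨ cong (λ v → + m + v) (ℤ.*-zeroʳ (- + k)) ⟩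
      + m + + 0                ≡⟨ ℤ.+-identityʳ (+ m) ⟩
      + m                      ∎
      where open ≡-Reasoning
    r∣m : r ∣ m
    r∣m = ∣⇒∣ᵤ (subst (+ r ℤ.∣_) coefficient≡m (r∣coefficient j (s≤s (reduce≤ P d))))
    0<m : 0 < m
    0<m = filter-some (_≟ j) (Any.map sym (∈-map⁺ (reduce P) d∈ds))
    m<k : m < k
    m<k = subst (m <_) (length-map (reduce P) (divisors n)) (filter-notAll (_≟ j) es ∃e≢j)
      where
      ∃e≢j : Any.Any (_≢ j) es
      ∃e≢j = Any.map (λ 1≡e e≡j → j≢1 (trans (sym e≡j) (sym 1≡e)))
                     (∈-map⁺ (reduce P) (∣⇒∈divisors (1∣ n)))

  pred∣pred-divisor : ∀ {d} → d ∈ divisors n → suc t ∣ ℕ.pred d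
  pred∣pred-divisor {d} d∈ds = reduce≡1⇒∣pred P d (reduce-divisor≡1 d∈ds)

prime-divisor-bound : ∀ {n r q} .{{_ : NonZero n}} → WeaklyAlmostPrime n →
  Prime r → r ∣ n → numDivisors n ≤ r → Prime q → q ∣ n → r ≤ q
prime-divisor-bound {n} {2+ t} {2+ u} wap r-prime r∣n k≤r q-prime q∣n =
  s≤s (∣⇒≤ (pred∣pred-divisor r-prime r∣T k≤r (∣⇒∈divisors q∣n)))
  where
  r∣T : ∀ x → + 2+ t ℤ.∣ T n x
  r∣T x = ∣ᵤ⇒∣ (∣-trans r∣n (wap x))

∃-prime-divisor : ∀ m .{{_ : NonZero m}} → m ≢ 1 → ∃[ q ] Prime q × q ∣ m
∃-prime-divisor m m≢1 with factorise m
... | record { factors = [] ; isFactorisation = m≡1 } = contradiction m≡1 m≢1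
... | record { factors = q ∷ qs ; isFactorisation = m≡qΠqs ; factorsPrime = q-prime ∷ _ } =
  q , q-prime , subst (q ∣_) (sym m≡qΠqs) (m∣m*n (product qs))

squarefree⇒other-prime-divisor : ∀ {n p} → Composite n → SquareFree n → Prime p → p ∣ n →
  ∃[ q ] Prime q × q ∣ n × q ≢ p
squarefree⇒other-prime-divisor {n} {p} n-composite n-squarefree p-prime (divides m n≡mp) =
  extend (∃-prime-divisor m {{m≢0}} m≢1)
  where
  m≢0 : NonZero m
  m≢0 = ℕ.m*n≢0⇒m≢0 m {{subst NonZero n≡mp (composite⇒nonZero n-composite)}}
  m≢1 : m ≢ 1
  m≢1 refl = composite⇒¬prime (subst Composite (trans n≡mp (ℕ.*-identityˡ p)) n-composite) p-prime
  extend : ∃[ q ] Prime q × q ∣ m → ∃[ q ] Prime q × q ∣ n × q ≢ p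
  extend (q , q-prime , q∣m) = q , q-prime , ∣-trans q∣m m∣n , q≢p
    where
    m∣n : m ∣ n
    m∣n = divides p (trans n≡mp (ℕ.*-comm m p))
    q≢p : q ≢ p
    q≢p refl = n-squarefree p p-prime (subst (p ℕ.* p ∣_) (sym n≡mp) (*-monoˡ-∣ p q∣m))

corollary2p2 : ∀ (n : ℕ) → Composite n → AlmostPrime n →
    ∀ (p : ℕ) → Prime p → p ∣ n → p < numDivisors n
corollary2p2 n n-composite (wap , n-squarefree) p p-prime p∣n = ℕ.≰⇒> k≰p
  where
  instance
    n≢0 : NonZero n
    n≢0 = composite⇒nonZero n-composite
  k≰p : ¬ numDivisors n ≤ p
  k≰p k≤p with squarefree⇒other-prime-divisor n-composite n-squarefree p-prime p∣n
  ... | q , q-prime , q∣n , q≢p = q≢p (ℕ.≤-antisym q≤p p≤q)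
    where
    p≤q : p ≤ q
    p≤q = prime-divisor-bound wap p-prime p∣n k≤p q-prime q∣n
    q≤p : q ≤ p
    q≤p = prime-divisor-bound wap q-prime q∣n (ℕ.≤-trans k≤p p≤q) p-prime p∣n
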